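{- Let $x$ be a shuffle tableau of shape $(\lambda/\mu)\circledast(\nu/\rho)$ whose reading word contains, in this order, an entry $i+1$, an entry $i$, and an entry $i$, where the first $i+1$ and the last $i$ are paired with each other, while the middle $i$ is unpaired. Then the paired $i+1$ and $i$ are column paired.
   Context: A shuffle tableau of shape $(\lambda/\mu)\circledast(\nu/\rho)$ ($n$ rows each) is a pair $(T,U)$ of semistandard tableaux of shapes $\lambda/\mu$, $\nu/\rho$; row $r$ of $T$ sits at level $2r-1$, row $r$ of $U$ at level $2r$. Reading word: levels $2n,\dots,1$, each left to right. An $i$ in cell $(r,c)$ and $i+1$ in cell $(r+1,c)$ of the same tableau are column paired. Pairing for index $i$: first the column-paired $(i,i+1)$ pairs are paired with each other; among the remaining letters of the reading word, each $i$ (as ")") is matched with an $i+1$ (as "(") by the usual bracket matching, and matched letters are paired with each other. An $i$ not paired with any $i+1$ is unpaired. -}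

module Defs where

open import Data.Nat using (ℕ; zero; suc; _+_; _∸_; _≤_; _<_; _≡ᵇ_)
open import Data.Nat.Properties using (_≟_)
open import Data.Bool using (Bool; true; false; _∧_; _∨_; if_then_else_)
import Data.Bool.Properties as BoolP
open import Data.Fin using (Fin; toℕ)
import Data.Fin as F
open import Data.List using (List; []; _∷_; map; upTo; allFin; reverse; concatMap; _++_; length; zip; lookup)
open import Data.Bool.ListAction using (any)
open import Data.Product using (_×_; _,_)
open import Relation.Nullary using (Dec; does; yes; no)
open import Relation.Nullary.Decidable using (_×-dec_)
open import Relation.Binary.PropositionalEquality using (_≡_)

-- Rows are indexed by Fin n (row 0 = top row, English convention),
-- columns by ℕ (0-indexed).

IsPartition : ∀ {n} → (Fin n → ℕ) → Set
IsPartition {n} p = ∀ (r r' : Fin n) → r F.≤ r' → p r' ≤ p r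

_⊆ₚ_ : ∀ {n} → (Fin n → ℕ) → (Fin n → ℕ) → Set
_⊆ₚ_ {n} inn out = ∀ (r : Fin n) → inn r ≤ out r

InShape : ∀ {n} → (out inn : Fin n → ℕ) → Fin n → ℕ → Set
InShape out inn r c = inn r ≤ c × c < out r

-- A filling X : Fin n → ℕ → ℕ (only values on cells of the shape matter)
-- is a semistandard tableau of shape out/inn.
record IsSSYT {n} (out inn : Fin n → ℕ) (X : Fin n → ℕ → ℕ) : Set where
  field
    positive : ∀ r c → InShape out inn r c → 1 ≤ X r c
    rowWeak  : ∀ r c → InShape out inn r c → InShape out inn r (suc c) →
               X r c ≤ X r (suc c)
    colStrict : ∀ (r r' : Fin n) c → toℕ r' ≡ suc (toℕ r) →
               InShape out inn r c → InShape out inn r' c → X r c < X r' c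

-- Letters of the reading word of a shuffle tableau (T , U):
-- tab = false for T, true for U; row (0-indexed), col (0-indexed), value.

record Letter : Set where
  constructor letter
  field
    tab : Bool
    row : ℕ
    col : ℕ
    val : ℕ
open Letter public

range : ℕ → ℕ → List ℕ
range a b = map (a +_) (upTo (b ∸ a))

rowWord : ∀ {n} → Bool → (out inn : Fin n → ℕ) → (Fin n → ℕ → ℕ) → Fin n → List Letter
rowWord t out inn X r = map (λ c → letter t (toℕ r) c (X r c)) (range (inn r) (out r))

-- Reading word of the shuffle tableau (T , U) of shape (la/mu) ⊛ (nu/rho):
-- levels 2n, 2n-1, ..., 1, where level 2r is row r of U and level 2r-1 is
-- row r of T (rows 1-indexed), each level read left to right.
readingWord : ∀ {n} → (la mu nu rho : Fin n → ℕ) → (T U : Fin n → ℕ → ℕ) → List Letter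
readingWord {n} la mu nu rho T U =
  concatMap (λ r → rowWord true nu rho U r ++ rowWord false la mu T r) (reverse (allFin n))

ColPaired : ℕ → Letter → Letter → Set
ColPaired i a b =
  tab a ≡ tab b × suc (row a) ≡ row b × col a ≡ col b × val a ≡ i × val b ≡ suc i

colPaired? : ∀ i a b → Dec (ColPaired i a b)
colPaired? i a b =
  BoolP._≟_ (tab a) (tab b) ×-dec (suc (row a) ≟ row b) ×-dec (col a ≟ col b)
    ×-dec (val a ≟ i) ×-dec (val b ≟ suc i)

cp : ℕ → Letter → Letter → Bool
cp i a b = does (colPaired? i a b)

indexed : List Letter → List (ℕ × Letter)
indexed w = zip (upTo (length w)) w

-- Pairs (position of the i+1 , position of the i) that are column paired.
colPairList : ℕ → List Letter → List (ℕ × ℕ)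
colPairList i w =
  concatMap (λ { (k , a) → concatMap (λ { (j , b) → if cp i a b then (j , k) ∷ [] else [] })
                                      (indexed w) })
            (indexed w)

-- Bracket matching on the letters not column paired: i+1 is "(", i is ")".
data Kind : Set where
  opn  : ℕ → Kind
  cls  : ℕ → Kind
  skip : Kind

kindOf : ℕ → List Letter → ℕ × Letter → Kind
kindOf i w (k , a) =
  if any (λ b → cp i a b ∨ cp i b a) w then skip
  else (if val a ≡ᵇ suc i then opn k
  else (if val a ≡ᵇ i then cls k else skip))

-- stack of unmatched "(" positions; output (position of "(" , position of ")")
scan : List ℕ → List Kind → List (ℕ × ℕ)
scan st [] = []
scan st (opn k ∷ ks) = scan (k ∷ st) ks
scan [] (cls k ∷ ks) = scan [] ks
scan (j ∷ st) (cls k ∷ ks) = (j , k) ∷ scan st ks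
scan st (skip ∷ ks) = scan st ks

bracketPairList : ℕ → List Letter → List (ℕ × ℕ)
bracketPairList i w = scan [] (map (kindOf i w) (indexed w))

-- All pairs (position of an i+1 , position of an i) that are paired for index i.
pairList : ℕ → List Letter → List (ℕ × ℕ)
pairList i w = colPairList i w ++ bracketPairList i w

-- An i that is not column paired is a
-- closing bracket, and bracket matching is well nested: a ")" strictly between a
-- matched "(" and ")" is itself matched.  So a bracket pair cannot enclose an unpaired
-- i, and the pair around it must be a column pair.

module Submission where

open import Defs
open import Data.Bool using (Bool; true; false; T; _∨_; if_then_else_)
open import Data.Bool.Properties using (T-∨)
open import Data.Bool.ListAction using (any)
open import Data.Empty using (⊥-elim)
open import Data.Fin using (Fin; toℕ; _<_)
import Data.Fin as Fin
open import Data.Fin.Properties using (toℕ-injective)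
open import Data.List using (List; []; _∷_; length; lookup; map; applyUpTo; zip)
open import Data.List.Membership.Propositional using (_∈_; _∉_; find; lose)
open import Data.List.Membership.Propositional.Properties
  using (∈-++⁻; ∈-++⁺ˡ; ∈-++⁺ʳ; ∈-map⁺; ∈-concatMap⁺; ∈-concatMap⁻)
open import Data.List.Relation.Unary.All as All using (All; []; _∷_)
open import Data.List.Relation.Unary.Any as Any using (Any; here; there)
open import Data.List.Relation.Unary.Any.Properties using (any⁻; lookup-index)
open import Data.Nat as ℕ using (ℕ; zero; suc; _≤_; _≡ᵇ_)
open import Data.Nat.Properties using (≤-refl; ≤-trans; <-≤-trans; <-trans; ≤⇒≯; n≤1+n; n<1+n; m<n⇒m<1+n; 1+n≢n)
open import Data.Product using (_,_; _×_; Σ; ∃; proj₂)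
open import Data.Sum using (_⊎_; inj₁; inj₂)
open import Data.Unit using (⊤; tt)
open import Function using (_∘_; Equivalence)
open import Relation.Nullary using (¬_; Dec; does; yes)
open import Relation.Nullary.Decidable using (dec-true)
open import Relation.Binary.PropositionalEquality using (_≡_; refl; sym; trans; subst)

≡ᵇ-refl : ∀ n → (n ≡ᵇ n) ≡ true
≡ᵇ-refl zero = refl
≡ᵇ-refl (suc n) = ≡ᵇ-refl n

≡ᵇ-suc : ∀ n → (n ≡ᵇ suc n) ≡ false
≡ᵇ-suc zero = refl
≡ᵇ-suc (suc n) = ≡ᵇ-suc n

∈-if-singleton⁺ : ∀ {A : Set} {c : Bool} {z : A} → T c → z ∈ (if c then z ∷ [] else [])
∈-if-singleton⁺ {c = true} _ = here refl

∈-if-singleton⁻ : ∀ {A : Set} {c : Bool} {y z : A} → y ∈ (if c then z ∷ [] else []) → T c × y ≡ z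
∈-if-singleton⁻ {c = true} (here refl) = tt , refl

∈-zip-applyUpTo⁺ : ∀ {A : Set} (f : ℕ → ℕ) (w : List A) (x : Fin (length w)) →
  (f (toℕ x) , lookup w x) ∈ zip (applyUpTo f (length w)) w
∈-zip-applyUpTo⁺ f (a ∷ w) Fin.zero = here refl
∈-zip-applyUpTo⁺ f (a ∷ w) (Fin.suc x) = there (∈-zip-applyUpTo⁺ (f ∘ suc) w x)

∈-zip-applyUpTo⁻ : ∀ {A : Set} (f : ℕ → ℕ) (w : List A) {k a} →
  (k , a) ∈ zip (applyUpTo f (length w)) w →
  Σ (Fin (length w)) λ x → f (toℕ x) ≡ k × lookup w x ≡ a
∈-zip-applyUpTo⁻ f (b ∷ w) (here refl) = Fin.zero , refl , refl
∈-zip-applyUpTo⁻ f (b ∷ w) (there m) with x , fx≡k , wx≡a ← ∈-zip-applyUpTo⁻ (f ∘ suc) w m =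
  Fin.suc x , fx≡k , wx≡a

∈-indexed : ∀ w (x : Fin (length w)) → (toℕ x , lookup w x) ∈ indexed w
∈-indexed = ∈-zip-applyUpTo⁺ (λ n → n)

∈-indexed⇒lookup : ∀ w (x : Fin (length w)) {a} → (toℕ x , a) ∈ indexed w → lookup w x ≡ a
∈-indexed⇒lookup w x m with y , y≡x , wy≡a ← ∈-zip-applyUpTo⁻ (λ n → n) w m
  rewrite toℕ-injective y≡x = wy≡a

AscendingFrom : ℕ → List Kind → Set
AscendingFrom b [] = ⊤
AscendingFrom b (opn k ∷ ks) = b ≤ k × AscendingFrom (suc k) ks
AscendingFrom b (cls k ∷ ks) = b ≤ k × AscendingFrom (suc k) ks
AscendingFrom b (skip ∷ ks) = AscendingFrom b ks

ascending-weaken : ∀ {b b′} ks → b ≤ b′ → AscendingFrom b′ ks → AscendingFrom b ks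
ascending-weaken [] b≤b′ asc = tt
ascending-weaken (opn k ∷ ks) b≤b′ (b′≤k , asc) = ≤-trans b≤b′ b′≤k , asc
ascending-weaken (cls k ∷ ks) b≤b′ (b′≤k , asc) = ≤-trans b≤b′ b′≤k , asc
ascending-weaken (skip ∷ ks) b≤b′ asc = ascending-weaken ks b≤b′ asc

ascending-tail : ∀ {b} κ ks → AscendingFrom b (κ ∷ ks) → AscendingFrom b ks
ascending-tail (opn k) ks (b≤k , asc) = ascending-weaken ks (≤-trans b≤k (n≤1+n k)) asc
ascending-tail (cls k) ks (b≤k , asc) = ascending-weaken ks (≤-trans b≤k (n≤1+n k)) asc
ascending-tail skip ks asc = asc

ascending-opn : ∀ {b x} ks → AscendingFrom b ks → opn x ∈ ks → b ≤ x
ascending-opn (opn k ∷ ks) (b≤k , _) (here refl) = b≤k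
ascending-opn (κ ∷ ks) asc (there m) = ascending-opn ks (ascending-tail κ ks asc) m

ascending-cls : ∀ {b x} ks → AscendingFrom b ks → cls x ∈ ks → b ≤ x
ascending-cls (cls k ∷ ks) (b≤k , _) (here refl) = b≤k
ascending-cls (κ ∷ ks) asc (there m) = ascending-cls ks (ascending-tail κ ks asc) m

scan-opener : ∀ st ks {o c} → (o , c) ∈ scan st ks → o ∈ st ⊎ opn o ∈ ks
scan-opener st [] ()
scan-opener st (opn k ∷ ks) m with scan-opener (k ∷ st) ks m
... | inj₁ (here refl) = inj₂ (here refl)
... | inj₁ (there o∈st) = inj₁ o∈st
... | inj₂ o∈ks = inj₂ (there o∈ks)
scan-opener [] (cls k ∷ ks) m with scan-opener [] ks m
... | inj₂ o∈ks = inj₂ (there o∈ks)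
scan-opener (j ∷ st) (cls k ∷ ks) (here refl) = inj₁ (here refl)
scan-opener (j ∷ st) (cls k ∷ ks) (there m) with scan-opener st ks m
... | inj₁ o∈st = inj₁ (there o∈st)
... | inj₂ o∈ks = inj₂ (there o∈ks)
scan-opener st (skip ∷ ks) m with scan-opener st ks m
... | inj₁ o∈st = inj₁ o∈st
... | inj₂ o∈ks = inj₂ (there o∈ks)

below-push : ∀ {b k} {st : List ℕ} → b ≤ k → All (ℕ._< b) st → All (ℕ._< suc k) st
below-push b≤k = All.map (λ j<b → m<n⇒m<1+n (<-≤-trans j<b b≤k))

scan-nested : ∀ b st ks {o c x} → AscendingFrom b ks → All (ℕ._< b) st →
  (o , c) ∈ scan st ks → cls x ∈ ks → o ℕ.< x → x ℕ.< c → ∃ λ j → (j , x) ∈ scan st ks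
scan-nested b st (opn k ∷ ks) (b≤k , asc) st<b m (there x∈ks) o<x x<c =
  scan-nested (suc k) (k ∷ st) ks asc (n<1+n k ∷ below-push b≤k st<b) m x∈ks o<x x<c
scan-nested b st (skip ∷ ks) asc st<b m (there x∈ks) o<x x<c =
  scan-nested b st ks asc st<b m x∈ks o<x x<c
scan-nested b [] (cls k ∷ ks) (_ , asc) _ m (here refl) o<x x<c with scan-opener [] ks m
... | inj₂ o∈ks = ⊥-elim (≤⇒≯ (ascending-opn ks asc o∈ks) (<-trans o<x (n<1+n k)))
scan-nested b [] (cls k ∷ ks) (_ , asc) _ m (there x∈ks) o<x x<c =
  scan-nested (suc k) [] ks asc [] m x∈ks o<x x<c
scan-nested b (j ∷ st) (cls k ∷ ks) _ _ _ (here refl) _ _ = j , here refl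
scan-nested b (j ∷ st) (cls k ∷ ks) (_ , asc) _ (here refl) (there x∈ks) _ x<c =
  ⊥-elim (≤⇒≯ (ascending-cls ks asc x∈ks) (<-trans x<c (n<1+n k)))
scan-nested b (j ∷ st) (cls k ∷ ks) (b≤k , asc) (_ ∷ st<b) (there m) (there x∈ks) o<x x<c
  with j′ , matched ← scan-nested (suc k) st ks asc (below-push b≤k st<b) m x∈ks o<x x<c =
  j′ , there matched

does⇒witness : ∀ {A : Set} (d : Dec A) → T (does d) → A
does⇒witness (yes a) _ = a

cp⇒ColPaired : ∀ i a b → T (cp i a b) → ColPaired i a b
cp⇒ColPaired i a b = does⇒witness (colPaired? i a b)

ColPaired⇒cp : ∀ {i a b} → ColPaired i a b → T (cp i a b)
ColPaired⇒cp {i} {a} {b} c = subst T (sym (dec-true (colPaired? i a b) c)) tt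

colPairList-sound : ∀ i w (p s : Fin (length w)) →
  (toℕ p , toℕ s) ∈ colPairList i w → ColPaired i (lookup w s) (lookup w p)
colPairList-sound i w p s m
  with (k , a) , ka∈w , m′ ← find (∈-concatMap⁻ _ {xs = indexed w} m)
  with (j , b) , jb∈w , m″ ← find (∈-concatMap⁻ _ {xs = indexed w} m′)
  with cpab , refl ← ∈-if-singleton⁻ {c = cp i a b} m″
  rewrite ∈-indexed⇒lookup w s ka∈w | ∈-indexed⇒lookup w p jb∈w = cp⇒ColPaired i a b cpab

colPairList-complete : ∀ i w (x y : Fin (length w)) →
  ColPaired i (lookup w x) (lookup w y) → (toℕ y , toℕ x) ∈ colPairList i w
colPairList-complete i w x y c =
  ∈-concatMap⁺ _ (lose (∈-indexed w x) (∈-concatMap⁺ _ (lose (∈-indexed w y) pair)))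
  where
  pair : (toℕ y , toℕ x) ∈ (if cp i (lookup w x) (lookup w y) then (toℕ y , toℕ x) ∷ [] else [])
  pair = ∈-if-singleton⁺ (ColPaired⇒cp c)

kinds : ℕ → List Letter → List Kind
kinds i w = map (kindOf i w) (indexed w)

ascending-kindOf : ∀ i w {b k a} ks → b ≤ k → AscendingFrom (suc k) ks →
  AscendingFrom b (kindOf i w (k , a) ∷ ks)
ascending-kindOf i w {b} {k} {a} ks b≤k asc with any (λ c → cp i a c ∨ cp i c a) w
... | true = ascending-weaken ks (≤-trans b≤k (n≤1+n k)) asc
... | false with val a ≡ᵇ suc i
...   | true = b≤k , asc
...   | false with val a ≡ᵇ i
...     | true = b≤k , asc
...     | false = ascending-weaken ks (≤-trans b≤k (n≤1+n k)) asc

ascending-kinds-from : ∀ i w (f : ℕ → ℕ) (v : List Letter) → (∀ n → f n ℕ.< f (suc n)) →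
  AscendingFrom (f 0) (map (kindOf i w) (zip (applyUpTo f (length v)) v))
ascending-kinds-from i w f [] f-mono = tt
ascending-kinds-from i w f (a ∷ v) f-mono =
  ascending-kindOf i w {k = f 0} {a = a} rest ≤-refl
    (ascending-weaken rest (f-mono 0) (ascending-kinds-from i w (f ∘ suc) v (f-mono ∘ suc)))
  where
  rest : List Kind
  rest = map (kindOf i w) (zip (applyUpTo (f ∘ suc) (length v)) v)

ascending-kinds : ∀ i w → AscendingFrom 0 (kinds i w)
ascending-kinds i w = ascending-kinds-from i w (λ n → n) w n<1+n

kindOf-isolated-i : ∀ i w {k a} → val a ≡ i →
  ¬ Any (λ b → T (cp i a b ∨ cp i b a)) w → kindOf i w (k , a) ≡ cls k
kindOf-isolated-i i w {k} {a} refl isolated with any (λ b → cp i a b ∨ cp i b a) w in e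
... | true = ⊥-elim (isolated (any⁻ _ w (subst T (sym e) tt)))
... | false rewrite ≡ᵇ-suc (val a) | ≡ᵇ-refl (val a) = refl

closer-of-unpaired : ∀ i w (q : Fin (length w)) → val (lookup w q) ≡ i →
  (∀ j → (j , toℕ q) ∉ colPairList i w) → cls (toℕ q) ∈ kinds i w
closer-of-unpaired i w q vq unpaired =
  subst (_∈ kinds i w) (kindOf-isolated-i i w vq isolated) (∈-map⁺ (kindOf i w) (∈-indexed w q))
  where
  not-partner : ∀ y → ¬ T (cp i (lookup w q) (lookup w y) ∨ cp i (lookup w y) (lookup w q))
  not-partner y c with Equivalence.to T-∨ c
  ... | inj₁ c = unpaired _ (colPairList-complete i w q y (cp⇒ColPaired i (lookup w q) (lookup w y) c))
  ... | inj₂ c with _ , _ , _ , _ , vq≡1+i ← cp⇒ColPaired i (lookup w y) (lookup w q) c =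
    1+n≢n (trans (sym vq≡1+i) vq)

  isolated : ¬ Any (λ b → T (cp i (lookup w q) b ∨ cp i b (lookup w q))) w
  isolated partner = not-partner (Any.index partner) (lookup-index partner)

pair-around-unpaired⇒ColPaired : ∀ i w (p q s : Fin (length w)) → p < q → q < s →
  val (lookup w q) ≡ i → (toℕ p , toℕ s) ∈ pairList i w → (∀ j → (j , toℕ q) ∉ pairList i w) →
  ColPaired i (lookup w s) (lookup w p)
pair-around-unpaired⇒ColPaired i w p q s p<q q<s vq paired unpaired
  with ∈-++⁻ (colPairList i w) paired
... | inj₁ column = colPairList-sound i w p s column
... | inj₂ bracket = ⊥-elim (unpaired _ (∈-++⁺ʳ (colPairList i w) (proj₂ q-matched)))
  where
  q-matched : ∃ λ j → (j , toℕ q) ∈ bracketPairList i w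
  q-matched = scan-nested 0 [] (kinds i w) (ascending-kinds i w) [] bracket
    (closer-of-unpaired i w q vq (λ j m → unpaired j (∈-++⁺ˡ m))) p<q q<s

lemma5p2 : ∀ {n} (la mu nu rho : Fin n → ℕ) →
    IsPartition la → IsPartition mu → IsPartition nu → IsPartition rho →
    mu ⊆ₚ la → rho ⊆ₚ nu →
    (T U : Fin n → ℕ → ℕ) → IsSSYT la mu T → IsSSYT nu rho U →
    (i : ℕ) (p q s : Fin (length (readingWord la mu nu rho T U))) →
    p < q → q < s →
    val (lookup (readingWord la mu nu rho T U) p) ≡ suc i →
    val (lookup (readingWord la mu nu rho T U) q) ≡ i →
    val (lookup (readingWord la mu nu rho T U) s) ≡ i →
    (toℕ p , toℕ s) ∈ pairList i (readingWord la mu nu rho T U) →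
    (∀ (j : ℕ) → (j , toℕ q) ∉ pairList i (readingWord la mu nu rho T U)) →
    ColPaired i (lookup (readingWord la mu nu rho T U) s) (lookup (readingWord la mu nu rho T U) p)
lemma5p2 la mu nu rho _ _ _ _ _ _ T U _ _ i p q s p<q q<s _ vq _ =
  pair-around-unpaired⇒ColPaired i (readingWord la mu nu rho T U) p q s p<q q<s vq
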